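{- Let $G$ be a finite simple graph with $n \ge 2$ vertices. If $G$ has a subgraph isomorphic to the path $P_n$ on $n$ vertices, then $\gamma(M(G)) = \left\lceil \frac{n}{2}\right\rceil$.
   Context: For a finite simple graph $H$, the middle graph $M(H)$ is the graph with vertex set $V(H)\cup E(H)$ in which two elements $x,y$ are adjacent if and only if either (1) $x,y\in E(H)$ and the edges $x,y$ share a common endpoint in $H$, or (2) $x\in V(H)$, $y\in E(H)$ and $x$ is an endpoint of $y$ (or vice versa). A dominating set of a graph $H$ is a set $S\subseteq V(H)$ such that every vertex of $H$ is in $S$ or adjacent to a vertex of $S$; the domination number $\gamma(H)$ is the minimum cardinality of a dominating set of $H$. -}

module Defs where

open import Data.Nat using (ℕ; suc; _≤_; _+_)
open import Data.Nat.Base using (⌈_/2⌉)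
open import Data.Fin using (Fin; toℕ; _<_; inject₁)
import Data.Fin as F
open import Data.Bool using (Bool; T)
open import Data.Product using (Σ; ∃; _×_; _,_; proj₁; proj₂)
open import Data.Sum using (_⊎_; inj₁; inj₂)
open import Data.List using (List; length)
open import Data.List.Relation.Unary.Unique.Propositional using (Unique)
open import Data.List.Relation.Unary.Any using (Any)
open import Data.List.Membership.Propositional using (_∈_)
open import Relation.Binary.PropositionalEquality using (_≡_)
open import Function.Bundles using (_↔_; Inverse)
open import Data.Empty using (⊥)
open import Relation.Nullary using (¬_)

record Graph (n : ℕ) : Set where
  field
    adj    : Fin n → Fin n → Bool
    sym    : ∀ u v → adj u v ≡ adj v u
    irrefl : ∀ u → T (adj u u) → ⊥
open Graph public using (adj; irrefl)

-- Edges of G: unordered pairs {u,v} represented as u < v with u ~ v.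
Edge : ∀ {n} → Graph n → Set
Edge {n} G = Σ (Fin n × Fin n) λ p → (proj₁ p < proj₂ p) × T (adj G (proj₁ p) (proj₂ p))

_isEndOf_ : ∀ {n} {G : Graph n} → Fin n → Edge G → Set
x isEndOf ((u , v) , _) = (x ≡ u) ⊎ (x ≡ v)

MVert : ∀ {n} → Graph n → Set
MVert {n} G = Fin n ⊎ Edge G

MAdj : ∀ {n} (G : Graph n) → MVert G → MVert G → Set
MAdj {n} G (inj₁ x) (inj₁ y) = ⊥
MAdj {n} G (inj₁ x) (inj₂ e) = _isEndOf_ {n} {G} x e
MAdj {n} G (inj₂ e) (inj₁ y) = _isEndOf_ {n} {G} y e
MAdj {n} G (inj₂ e) (inj₂ f) =
  (¬ (e ≡ f)) × ∃ λ x → _isEndOf_ {n} {G} x e × _isEndOf_ {n} {G} x f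

-- General graph notions: domination in an arbitrary (possibly infinite-type)
-- graph given by vertex type and adjacency relation; sets are duplicate-free lists.
Dominating : {V : Set} (A : V → V → Set) → List V → Set
Dominating {V} A S = ∀ (v : V) → (v ∈ S) ⊎ Any (λ s → A s v) S

DominationNumber : {V : Set} (A : V → V → Set) → ℕ → Set
DominationNumber A k =
  (∃ λ S → Unique S × Dominating A S × length S ≡ k)
  × (∀ S → Unique S → Dominating A S → k ≤ length S)

-- G has a subgraph isomorphic to P_n (n = |V(G)|): a bijective labelling
-- π of the vertices with π i ~ π (i+1) for consecutive i.
HasSpanningPath : ∀ {n} → Graph n → Set
HasSpanningPath {n} G =
  Σ (Fin n ↔ Fin n) λ π →
    ∀ (i j : Fin n) → toℕ j ≡ suc (toℕ i) →
      T (adj G (Inverse.to π i) (Inverse.to π j))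

module Submission where

-- Lower bound (any G): vertices of G are pairwise non-adjacent in M(G), so a
-- vertex x is dominated only by x itself or by an edge ending at x.  Each
-- member of a dominating set thus accounts for at most two of the n
-- vertices of G, whence n ≤ 2|S|.
-- Upper bound: every edge cover C of G dominates M(G), since an edge shares
-- an endpoint with the member of C covering that endpoint.  Along the path
-- v₀ … v_{n-1} the ⌈n/2⌉ edges v₂ₖv₂ₖ₊₁ (the last shifted to v_{n-2}v_{n-1}
-- for odd n) form an edge cover; deduplicating it and using the lower bound
-- gives γ = ⌈n/2⌉.

open import Defs
open import Data.Nat using (ℕ; _≤_)
open import Data.Nat.Base using (⌈_/2⌉)
open import Data.Nat.Base using (suc; _+_; _*_; _⊓_; _<_; ⌊_/2⌋; z≤n; s≤s)
import Data.Nat.Properties as ℕP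
open import Data.Fin.Base as Fin using (Fin; toℕ; fromℕ<; inject₁)
import Data.Fin.Properties as FinP
open import Data.Bool.Base using (T)
open import Data.Bool.Properties using (T-irrelevant)
open import Data.Product using (_,_; proj₁; proj₂)
import Data.Product.Properties as ΣP
open import Data.Sum using (_⊎_; inj₁; inj₂)
import Data.Sum as Sum
import Data.Sum.Properties as ⊎P
open import Data.List using (List; []; _∷_; length; map; concatMap; upTo; deduplicate)
import Data.List.Properties as ListP
open import Data.List.Relation.Unary.Any as Any using (Any; here; there)
import Data.List.Relation.Unary.Any.Properties as AnyP
open import Data.List.Membership.Propositional using (_∈_; lose)
import Data.List.Membership.Propositional.Properties as ∈P
import Data.List.Membership.Setoid.Properties as SetoidMembership
open import Data.List.Relation.Unary.Unique.Propositional using (Unique)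
open import Data.List.Relation.Unary.Unique.DecPropositional.Properties using (deduplicate-!)
open import Relation.Binary.PropositionalEquality
open import Relation.Binary.Definitions using (DecidableEquality; tri<; tri≈; tri>)
open import Relation.Nullary using (yes; no)
open import Data.Empty using (⊥-elim)
open import Function.Base using (_∘_)
open import Function.Bundles using (Inverse)

half-decomposition : ∀ i → (i ≡ ⌊ i /2⌋ + ⌊ i /2⌋) ⊎ (i ≡ suc (⌊ i /2⌋ + ⌊ i /2⌋))
half-decomposition 0 = inj₁ refl
half-decomposition 1 = inj₂ refl
half-decomposition (suc (suc i)) =
  Sum.map (λ e → trans (cong (suc ∘ suc) e) (double-suc h))
          (λ e → trans (cong (suc ∘ suc) e) (cong suc (double-suc h)))
          (half-decomposition i)
  where
  h = ⌊ i /2⌋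
  double-suc : ∀ k → suc (suc (k + k)) ≡ suc k + suc k
  double-suc k = cong suc (sym (ℕP.+-suc k k))

⌊i/2⌋<⌈n/2⌉ : ∀ {i n} → i < n → ⌊ i /2⌋ < ⌈ n /2⌉
⌊i/2⌋<⌈n/2⌉ {n = suc n} (s≤s i≤n) = s≤s (ℕP.⌊n/2⌋-mono i≤n)

⌈n/2⌉-least : ∀ {n s} → n ≤ s + s → ⌈ n /2⌉ ≤ s
⌈n/2⌉-least {s = s} n≤2s =
  ℕP.≤-trans (ℕP.⌈n/2⌉-mono n≤2s) (ℕP.≤-reflexive (sym (ℕP.n≡⌈n+n/2⌉ s)))

-- Shifting the pair {a, a+1} back to {a ⊓ m, a ⊓ m + 1} keeps every member
-- that is at most m + 1; this handles the last path edge when n is odd.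
clamp-pair : ∀ {i a} m → i ≤ suc m → (i ≡ a) ⊎ (i ≡ suc a) →
             (i ≡ a ⊓ m) ⊎ (i ≡ suc (a ⊓ m))
clamp-pair {i} {a} m i≤1+m i∈pair with a ℕP.≤? m
... | yes a≤m rewrite ℕP.m≤n⇒m⊓n≡m a≤m = i∈pair
... | no a≰m rewrite ℕP.m≥n⇒m⊓n≡n (ℕP.<⇒≤ (ℕP.≰⇒> a≰m)) =
  inj₂ (ℕP.≤-antisym i≤1+m (ℕP.≤-trans (ℕP.≰⇒> a≰m) a≤i))
  where
  a≤i : a ≤ i
  a≤i = Sum.[ ℕP.≤-reflexive ∘ sym
            , (λ e → ℕP.≤-trans (ℕP.n≤1+n a) (ℕP.≤-reflexive (sym e))) ] i∈pair

-- A list containing every element of Fin n has length at least n, as the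
-- index of an element's first occurrence is injective.
enumeration-length : ∀ {n} (L : List (Fin n)) → (∀ x → x ∈ L) → n ≤ length L
enumeration-length {n} L complete =
  FinP.injective⇒≤ {f = λ x → Any.index (complete x)}
    (λ {x} {y} → SetoidMembership.index-injective (setoid (Fin n)) (complete x) (complete y))

length-concatMap-≤ : ∀ {A B : Set} (f : A → List B) {c} → (∀ x → length (f x) ≤ c) →
                     ∀ xs → length (concatMap f xs) ≤ length xs * c
length-concatMap-≤ f bound [] = z≤n
length-concatMap-≤ f bound (x ∷ xs) =
  ℕP.≤-trans (ℕP.≤-reflexive (ListP.length-++ (f x)))
             (ℕP.+-mono-≤ (bound x) (length-concatMap-≤ f bound xs))

-- γ = k follows from a dominating list of length ≤ k (repetitions allowed)
-- together with the lower bound k ≤ |S| for every dominating set S: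
-- removing repetitions keeps the list dominating.
dominationNumber-from-list : ∀ {V : Set} {A : V → V → Set} {k} → DecidableEquality V →
  (S : List V) → Dominating A S → length S ≤ k →
  (∀ S → Unique S → Dominating A S → k ≤ length S) → DominationNumber A k
dominationNumber-from-list {A = A} _≟_ S dom |S|≤k lower =
  (S′ , S′-unique , S′-dom ,
   ℕP.≤-antisym (ℕP.≤-trans (ListP.length-deduplicate _≟_ S) |S|≤k) (lower S′ S′-unique S′-dom))
  , lower
  where
  S′ : List _
  S′ = deduplicate _≟_ S
  S′-unique : Unique S′
  S′-unique = deduplicate-! _≟_ S
  S′-dom : Dominating A S′
  S′-dom v = Sum.map (∈P.∈-deduplicate⁺ _≟_) (AnyP.deduplicate⁺ _≟_ (λ { refl a → a })) (dom v)

module MiddleGraph {n : ℕ} (G : Graph n) where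

  _∈ₑ_ : Fin n → Edge G → Set
  _∈ₑ_ = _isEndOf_ {n} {G}

  -- Edges are equal when their endpoints are (the proof components are irrelevant);
  -- decidable equality on M(G) is needed to remove repetitions from dominating lists.
  _≟ᴱ_ : DecidableEquality (Edge G)
  _≟ᴱ_ = ΣP.≡-dec (ΣP.≡-dec FinP._≟_ FinP._≟_)
           (λ (l , h) (l′ , h′) → yes (cong₂ _,_ (FinP.<-irrelevant l l′) (T-irrelevant h h′)))

  _≟ᴹ_ : DecidableEquality (MVert G)
  _≟ᴹ_ = ⊎P.≡-dec FinP._≟_ _≟ᴱ_

  edgeBetween : ∀ u v → T (adj G u v) → Edge G
  edgeBetween u v uv with FinP.<-cmp u v
  ... | tri< u<v _ _ = (u , v) , u<v , uv
  ... | tri≈ _ refl _ = ⊥-elim (irrefl G u uv)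
  ... | tri> _ _ v<u = (v , u) , v<u , subst T (Graph.sym G u v) uv

  edgeBetween-endpoint : ∀ u v uv {w} → (w ≡ u) ⊎ (w ≡ v) → w ∈ₑ edgeBetween u v uv
  edgeBetween-endpoint u v uv w∈uv with FinP.<-cmp u v
  ... | tri< _ _ _ = w∈uv
  ... | tri≈ _ refl _ = ⊥-elim (irrefl G u uv)
  ... | tri> _ _ _ = Sum.swap w∈uv

  dominatedVertices : MVert G → List (Fin n)
  dominatedVertices (inj₁ x) = x ∷ []
  dominatedVertices (inj₂ ((u , v) , _)) = u ∷ v ∷ []

  dominatedVertices-length : ∀ s → length (dominatedVertices s) ≤ 2
  dominatedVertices-length (inj₁ _) = s≤s z≤n
  dominatedVertices-length (inj₂ _) = s≤s (s≤s z≤n)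

  -- Vertices of G are pairwise non-adjacent in M(G), so a neighbour x of s
  -- is an endpoint of the edge s.
  adjacent⇒dominated : ∀ {x} s → MAdj G s (inj₁ x) → x ∈ dominatedVertices s
  adjacent⇒dominated (inj₂ _) (inj₁ refl) = here refl
  adjacent⇒dominated (inj₂ _) (inj₂ refl) = there (here refl)

  domination-lower-bound : ∀ S → Dominating (MAdj G) S → ⌈ n /2⌉ ≤ length S
  domination-lower-bound S dom = ⌈n/2⌉-least (begin
    n                                        ≤⟨ enumeration-length (concatMap dominatedVertices S) covered ⟩
    length (concatMap dominatedVertices S)   ≤⟨ length-concatMap-≤ dominatedVertices dominatedVertices-length S ⟩
    length S * 2                             ≡⟨ ℕP.*-comm (length S) 2 ⟩
    length S + (length S + 0)                ≡⟨ cong (length S +_) (ℕP.+-identityʳ (length S)) ⟩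
    length S + length S                      ∎)
    where
    open ℕP.≤-Reasoning
    covered : ∀ x → x ∈ concatMap dominatedVertices S
    covered x with dom (inj₁ x)
    ... | inj₁ x∈S = AnyP.concatMap⁺ dominatedVertices (Any.map (λ { refl → here refl }) x∈S)
    ... | inj₂ x~S = AnyP.concatMap⁺ dominatedVertices (Any.map (λ {s} → adjacent⇒dominated s) x~S)

  IsEdgeCover : List (Edge G) → Set
  IsEdgeCover C = ∀ x → Any (x ∈ₑ_) C

  edgeVertices : List (Edge G) → List (MVert G)
  edgeVertices = map inj₂

  dominated-through-endpoint : ∀ e {u} → u ∈ₑ e → ∀ {C} → Any (u ∈ₑ_) C →
    (inj₂ e ∈ edgeVertices C) ⊎ Any (λ s → MAdj G s (inj₂ e)) (edgeVertices C)
  dominated-through-endpoint e {u} u∈e (here {f} u∈f) with f ≟ᴱ e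
  ... | yes refl = inj₁ (here refl)
  ... | no f≢e = inj₂ (here (f≢e , u , u∈f , u∈e))
  dominated-through-endpoint e u∈e (there u∈C) =
    Sum.map there there (dominated-through-endpoint e u∈e u∈C)

  edgeCover⇒dominating : ∀ C → IsEdgeCover C → Dominating (MAdj G) (edgeVertices C)
  edgeCover⇒dominating C cover (inj₁ x) = inj₂ (AnyP.map⁺ (cover x))
  edgeCover⇒dominating C cover (inj₂ e@((u , _) , _)) =
    dominated-through-endpoint e (inj₁ refl) (cover u)

module PathCover {m : ℕ} (G : Graph (suc (suc m))) (P : HasSpanningPath G) where
  open MiddleGraph G

  n : ℕ
  n = suc (suc m)

  vertexAt position : Fin n → Fin n
  vertexAt = Inverse.to (proj₁ P)
  position = Inverse.from (proj₁ P)

  pathEdge : Fin (suc m) → Edge G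
  pathEdge j = edgeBetween (vertexAt (inject₁ j)) (vertexAt (Fin.suc j))
                 (proj₂ P (inject₁ j) (Fin.suc j) (cong suc (sym (FinP.toℕ-inject₁ j))))

  pathEdge-endpoint : ∀ x j → (toℕ (position x) ≡ toℕ j) ⊎ (toℕ (position x) ≡ suc (toℕ j)) →
                      x ∈ₑ pathEdge j
  pathEdge-endpoint x j at-j =
    edgeBetween-endpoint _ _ _
      (Sum.map (λ e → x-at (inject₁ j) (trans e (sym (FinP.toℕ-inject₁ j)))) (x-at (Fin.suc j)) at-j)
    where
    x-at : ∀ q → toℕ (position x) ≡ toℕ q → x ≡ vertexAt q
    x-at q e = trans (sym (Inverse.strictlyInverseˡ (proj₁ P) x)) (cong vertexAt (FinP.toℕ-injective e))

  -- The k-th selected edge joins positions 2k and 2k + 1, shifted back to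
  -- positions n - 2 and n - 1 when 2k + 1 = n.
  selectedStart : ℕ → Fin (suc m)
  selectedStart k = fromℕ< (s≤s (ℕP.m⊓n≤n (k + k) m))

  pathCover : List (Edge G)
  pathCover = map (pathEdge ∘ selectedStart) (upTo ⌈ n /2⌉)

  pathCover-length : length pathCover ≡ ⌈ n /2⌉
  pathCover-length = trans (ListP.length-map (pathEdge ∘ selectedStart) (upTo ⌈ n /2⌉))
                           (ListP.length-upTo ⌈ n /2⌉)

  -- The vertex at position i is covered by the selected edge number ⌊i/2⌋.
  pathCover-covers : IsEdgeCover pathCover
  pathCover-covers x =
    lose (∈P.∈-map⁺ (pathEdge ∘ selectedStart) (∈P.∈-upTo⁺ (⌊i/2⌋<⌈n/2⌉ i<n)))
         (pathEdge-endpoint x (selectedStart k) i∈selected)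
    where
    i = toℕ (position x)
    k = ⌊ i /2⌋
    i<n : i < n
    i<n = FinP.toℕ<n (position x)
    i∈selected : (i ≡ toℕ (selectedStart k)) ⊎ (i ≡ suc (toℕ (selectedStart k)))
    i∈selected = subst (λ t → (i ≡ t) ⊎ (i ≡ suc t)) (sym (FinP.toℕ-fromℕ< _))
                   (clamp-pair m (ℕP.≤-pred i<n) (half-decomposition i))

theorem3p9 : (n : ℕ) → 2 ≤ n → (G : Graph n) → HasSpanningPath G →
    DominationNumber (MAdj G) ⌈ n /2⌉
theorem3p9 (suc (suc m)) (s≤s (s≤s z≤n)) G P =
  dominationNumber-from-list _≟ᴹ_ (edgeVertices pathCover)
    (edgeCover⇒dominating pathCover pathCover-covers)
    (ℕP.≤-reflexive (trans (ListP.length-map inj₂ pathCover) pathCover-length))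
    (λ S _ → domination-lower-bound S)
  where
  open MiddleGraph G
  open PathCover G P
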